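{- Let $\mathcal C$ be a resource category and $\mathbf f$ a finite multiset of pointed morphisms $A\to B$. Then $\mathrm{id}^\bullet_B\circ\Pi\mathbf f=v$ if $\mathbf f=[v]$ is a singleton, and $\mathrm{id}^\bullet_B\circ\Pi\mathbf f=0$ otherwise.
   Context: An additive symmetric monoidal category is a symmetric monoidal category $(\otimes,I,\alpha,\lambda,\rho,\gamma)$ whose hom-sets are commutative monoids $(+,0)$ with composition and $\otimes$ preserving sums and $0$ in each argument. A bialgebra on $A$: $\delta_A:A\to A\otimes A$, $\epsilon_A:A\to I$, $\mu_A:A\otimes A\to A$, $\eta_A:I\to A$ with $(A,\mu_A,\eta_A)$ a commutative monoid, $(A,\delta_A,\epsilon_A)$ a commutative comonoid, and (up to structural isomorphisms) $\delta_A\circ\mu_A=(\mu_A\otimes\mu_A)\circ(A\otimes\gamma_{A,A}\otimes A)\circ(\delta_A\otimes\delta_A)$, $\delta_A\circ\eta_A=\eta_A\otimes\eta_A$, $\epsilon_A\circ\mu_A=\epsilon_A\otimes\epsilon_A$, $\epsilon_A\circ\eta_A=\mathrm{id}_I$. A pointed identity on $A$: an idempotent $\mathrm{id}^\bullet_A$ with (up to unitors) $\delta_A\circ\mathrm{id}^\bullet_A=\mathrm{id}^\bullet_A\otimes\eta_A+\eta_A\otimes\mathrm{id}^\bullet_A$, $\mathrm{id}^\bullet_A\circ\mu_A=\mathrm{id}^\bullet_A\otimes\epsilon_A+\epsilon_A\otimes\mathrm{id}^\bullet_A$, $\epsilon_A\circ\mathrm{id}^\bullet_A=0$, $\mathrm{id}^\bullet_A\circ\eta_A=0$.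 A resource category is an additive symmetric monoidal category where each object has a bialgebra structure and a pointed identity, compatible with $\otimes$: up to associativity isomorphisms $\delta_{A\otimes B}=(A\otimes\gamma_{A,B}\otimes B)\circ(\delta_A\otimes\delta_B)$, $\epsilon_{A\otimes B}=\lambda_I\circ(\epsilon_A\otimes\epsilon_B)$, $\epsilon_I=\mathrm{id}_I$, and dually $\mu_{A\otimes B}=(\mu_A\otimes\mu_B)\circ(A\otimes\gamma_{B,A}\otimes B)$, $\eta_{A\otimes B}=(\eta_A\otimes\eta_B)\circ\lambda_I^{ -1}$, $\eta_I=\mathrm{id}_I$. Notation: $1=\eta_B\circ\epsilon_A\in\mathcal C(A,B)$; $f*g=\mu_B\circ(f\otimes g)\circ\delta_A$; $\Pi[f_1,\dots,f_n]=f_1*\cdots*f_n$ with $\Pi[\,]=1$; $f:A\to B$ is pointed if $\mathrm{id}^\bullet_B\circ f=f$. -}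

module Defs where

open import Level using (Level; _⊔_; suc)
open import Relation.Binary using (Rel; IsEquivalence)
open import Data.List using (List; []; _∷_)

record AdditiveSMC (o ℓ e : Level) : Set (suc (o ⊔ ℓ ⊔ e)) where
  infix  4 _≈_
  infixr 9 _∘_
  infixr 10 _⊗₀_ _⊗₁_
  infixl 6 _+_
  field
    Obj : Set o
    _⇒_ : Obj → Obj → Set ℓ
    _≈_ : ∀ {A B} → Rel (A ⇒ B) e
    ≈-equiv : ∀ {A B} → IsEquivalence (_≈_ {A} {B})
    id  : ∀ {A} → A ⇒ A
    _∘_ : ∀ {A B C} → B ⇒ C → A ⇒ B → A ⇒ C
    assoc     : ∀ {A B C D} {f : A ⇒ B} {g : B ⇒ C} {h : C ⇒ D} →
                (h ∘ g) ∘ f ≈ h ∘ (g ∘ f)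
    identityˡ : ∀ {A B} {f : A ⇒ B} → id ∘ f ≈ f
    identityʳ : ∀ {A B} {f : A ⇒ B} → f ∘ id ≈ f
    ∘-resp-≈  : ∀ {A B C} {f h : B ⇒ C} {g i : A ⇒ B} →
                f ≈ h → g ≈ i → f ∘ g ≈ h ∘ i

    _⊗₀_ : Obj → Obj → Obj
    I    : Obj
    _⊗₁_ : ∀ {A B C D} → A ⇒ B → C ⇒ D → (A ⊗₀ C) ⇒ (B ⊗₀ D)
    ⊗-identity : ∀ {A B} → id {A} ⊗₁ id {B} ≈ id
    ⊗-homomorphism : ∀ {A B C D E F}
                       {f : A ⇒ B} {g : B ⇒ C} {h : D ⇒ E} {k : E ⇒ F} →
                     (g ∘ f) ⊗₁ (k ∘ h) ≈ (g ⊗₁ k) ∘ (f ⊗₁ h)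
    ⊗-resp-≈ : ∀ {A B C D} {f g : A ⇒ B} {h k : C ⇒ D} →
               f ≈ g → h ≈ k → f ⊗₁ h ≈ g ⊗₁ k

    α⇒ : ∀ {A B C} → ((A ⊗₀ B) ⊗₀ C) ⇒ (A ⊗₀ (B ⊗₀ C))
    α⇐ : ∀ {A B C} → (A ⊗₀ (B ⊗₀ C)) ⇒ ((A ⊗₀ B) ⊗₀ C)
    λ⇒ : ∀ {A} → (I ⊗₀ A) ⇒ A
    λ⇐ : ∀ {A} → A ⇒ (I ⊗₀ A)
    ρ⇒ : ∀ {A} → (A ⊗₀ I) ⇒ A
    ρ⇐ : ∀ {A} → A ⇒ (A ⊗₀ I)
    γ  : ∀ {A B} → (A ⊗₀ B) ⇒ (B ⊗₀ A)

    α-isoˡ : ∀ {A B C} → α⇐ {A} {B} {C} ∘ α⇒ ≈ id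
    α-isoʳ : ∀ {A B C} → α⇒ {A} {B} {C} ∘ α⇐ ≈ id
    λ-isoˡ : ∀ {A} → λ⇐ {A} ∘ λ⇒ ≈ id
    λ-isoʳ : ∀ {A} → λ⇒ {A} ∘ λ⇐ ≈ id
    ρ-isoˡ : ∀ {A} → ρ⇐ {A} ∘ ρ⇒ ≈ id
    ρ-isoʳ : ∀ {A} → ρ⇒ {A} ∘ ρ⇐ ≈ id
    γ-involutive : ∀ {A B} → γ {B} {A} ∘ γ {A} {B} ≈ id

    α-natural : ∀ {A A' B B' C C'} {f : A ⇒ A'} {g : B ⇒ B'} {h : C ⇒ C'} →
                α⇒ ∘ ((f ⊗₁ g) ⊗₁ h) ≈ (f ⊗₁ (g ⊗₁ h)) ∘ α⇒
    λ-natural : ∀ {A B} {f : A ⇒ B} → λ⇒ ∘ (id {I} ⊗₁ f) ≈ f ∘ λ⇒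
    ρ-natural : ∀ {A B} {f : A ⇒ B} → ρ⇒ ∘ (f ⊗₁ id {I}) ≈ f ∘ ρ⇒
    γ-natural : ∀ {A A' B B'} {f : A ⇒ A'} {g : B ⇒ B'} →
                γ ∘ (f ⊗₁ g) ≈ (g ⊗₁ f) ∘ γ

    pentagon : ∀ {A B C D} →
               (id {A} ⊗₁ α⇒ {B} {C} {D}) ∘ α⇒ ∘ (α⇒ ⊗₁ id {D})
                 ≈ α⇒ ∘ α⇒ {A ⊗₀ B} {C} {D}
    triangle : ∀ {A B} → (id {A} ⊗₁ λ⇒ {B}) ∘ α⇒ ≈ ρ⇒ ⊗₁ id {B}
    hexagon  : ∀ {A B C} →
               α⇒ {B} {C} {A} ∘ γ {A} {B ⊗₀ C} ∘ α⇒ {A} {B} {C}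
                 ≈ (id {B} ⊗₁ γ {A} {C}) ∘ α⇒ {B} {A} {C} ∘ (γ {A} {B} ⊗₁ id {C})

    _+_ : ∀ {A B} → A ⇒ B → A ⇒ B → A ⇒ B
    0#  : ∀ {A B} → A ⇒ B
    +-assoc    : ∀ {A B} {f g h : A ⇒ B} → (f + g) + h ≈ f + (g + h)
    +-comm     : ∀ {A B} {f g : A ⇒ B} → f + g ≈ g + f
    +-identityˡ : ∀ {A B} {f : A ⇒ B} → 0# + f ≈ f
    +-resp-≈   : ∀ {A B} {f g h k : A ⇒ B} → f ≈ g → h ≈ k → f + h ≈ g + k
    ∘-distribˡ-+ : ∀ {A B C} {h : B ⇒ C} {f g : A ⇒ B} →
                   h ∘ (f + g) ≈ (h ∘ f) + (h ∘ g)
    ∘-distribʳ-+ : ∀ {A B C} {f g : B ⇒ C} {h : A ⇒ B} →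
                   (f + g) ∘ h ≈ (f ∘ h) + (g ∘ h)
    ∘-zeroˡ : ∀ {A B C} {f : A ⇒ B} → 0# {B} {C} ∘ f ≈ 0#
    ∘-zeroʳ : ∀ {A B C} {f : B ⇒ C} → f ∘ 0# {A} {B} ≈ 0#
    ⊗-distribˡ-+ : ∀ {A B C D} {h : A ⇒ B} {f g : C ⇒ D} →
                   h ⊗₁ (f + g) ≈ (h ⊗₁ f) + (h ⊗₁ g)
    ⊗-distribʳ-+ : ∀ {A B C D} {f g : A ⇒ B} {h : C ⇒ D} →
                   (f + g) ⊗₁ h ≈ (f ⊗₁ h) + (g ⊗₁ h)
    ⊗-zeroˡ : ∀ {A B C D} {f : C ⇒ D} → 0# {A} {B} ⊗₁ f ≈ 0#
    ⊗-zeroʳ : ∀ {A B C D} {f : A ⇒ B} → f ⊗₁ 0# {C} {D} ≈ 0#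

  mid : ∀ {A B C D} → ((A ⊗₀ B) ⊗₀ (C ⊗₀ D)) ⇒ ((A ⊗₀ C) ⊗₀ (B ⊗₀ D))
  mid = α⇐ ∘ (id ⊗₁ α⇒) ∘ (id ⊗₁ (γ ⊗₁ id)) ∘ (id ⊗₁ α⇐) ∘ α⇒

record ResourceStructure {o ℓ e} (C : AdditiveSMC o ℓ e) : Set (o ⊔ ℓ ⊔ e) where
  open AdditiveSMC C
  field
    δ : ∀ A → A ⇒ (A ⊗₀ A)
    ε : ∀ A → A ⇒ I
    μ : ∀ A → (A ⊗₀ A) ⇒ A
    η : ∀ A → I ⇒ A
    id● : ∀ A → A ⇒ A

    μ-assoc : ∀ {A} → μ A ∘ (μ A ⊗₁ id) ≈ μ A ∘ (id ⊗₁ μ A) ∘ α⇒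
    μ-unitˡ : ∀ {A} → μ A ∘ (η A ⊗₁ id) ≈ λ⇒
    μ-unitʳ : ∀ {A} → μ A ∘ (id ⊗₁ η A) ≈ ρ⇒
    μ-comm  : ∀ {A} → μ A ∘ γ ≈ μ A
    δ-coassoc : ∀ {A} → α⇒ ∘ (δ A ⊗₁ id) ∘ δ A ≈ (id ⊗₁ δ A) ∘ δ A
    δ-counitˡ : ∀ {A} → (ε A ⊗₁ id) ∘ δ A ≈ λ⇐
    δ-counitʳ : ∀ {A} → (id ⊗₁ ε A) ∘ δ A ≈ ρ⇐
    δ-cocomm  : ∀ {A} → γ ∘ δ A ≈ δ A
    δ-μ : ∀ {A} → δ A ∘ μ A ≈ (μ A ⊗₁ μ A) ∘ mid ∘ (δ A ⊗₁ δ A)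
    δ-η : ∀ {A} → δ A ∘ η A ≈ (η A ⊗₁ η A) ∘ λ⇐ {I}
    ε-μ : ∀ {A} → ε A ∘ μ A ≈ λ⇒ {I} ∘ (ε A ⊗₁ ε A)
    ε-η : ∀ {A} → ε A ∘ η A ≈ id

    id●-idem : ∀ {A} → id● A ∘ id● A ≈ id● A
    δ-id●  : ∀ {A} → δ A ∘ id● A ≈ ((id● A ⊗₁ η A) ∘ ρ⇐) + ((η A ⊗₁ id● A) ∘ λ⇐)
    id●-μ  : ∀ {A} → id● A ∘ μ A ≈ (ρ⇒ ∘ (id● A ⊗₁ ε A)) + (λ⇒ ∘ (ε A ⊗₁ id● A))
    ε-id●  : ∀ {A} → ε A ∘ id● A ≈ 0#
    id●-η  : ∀ {A} → id● A ∘ η A ≈ 0#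

    δ-⊗ : ∀ {A B} → δ (A ⊗₀ B) ≈ mid ∘ (δ A ⊗₁ δ B)
    ε-⊗ : ∀ {A B} → ε (A ⊗₀ B) ≈ λ⇒ {I} ∘ (ε A ⊗₁ ε B)
    ε-I : ε I ≈ id
    μ-⊗ : ∀ {A B} → μ (A ⊗₀ B) ≈ (μ A ⊗₁ μ B) ∘ mid
    η-⊗ : ∀ {A B} → η (A ⊗₀ B) ≈ (η A ⊗₁ η B) ∘ λ⇐ {I}
    η-I : η I ≈ id

record ResourceCategory (o ℓ e : Level) : Set (suc (o ⊔ ℓ ⊔ e)) where
  field
    smc : AdditiveSMC o ℓ e
    res : ResourceStructure smc
  open AdditiveSMC smc public
  open ResourceStructure res public

  one : ∀ {A B} → A ⇒ B
  one {A} {B} = η B ∘ ε A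

  _*_ : ∀ {A B} → A ⇒ B → A ⇒ B → A ⇒ B
  _*_ {A} {B} f g = μ B ∘ (f ⊗₁ g) ∘ δ A

  Π : ∀ {A B} → List (A ⇒ B) → A ⇒ B
  Π []           = one
  Π (f ∷ [])     = f
  Π (f ∷ g ∷ fs) = f * Π (g ∷ fs)

  Pointed : ∀ {A B} → A ⇒ B → Set e
  Pointed {A} {B} f = id● B ∘ f ≈ f

{-# OPTIONS --safe #-}
module Submission where

-- A product g * h of two morphisms killed by ε is killed by id●: the
-- law id● ∘ μ = id● ⊗ ε + ε ⊗ id● leaves a factor ε ∘ g or ε ∘ h in each
-- summand.  A pointed f is killed by ε, since ε ∘ id● = 0, and ε ∘ μ = ε ⊗ ε
-- propagates this to every product with a pointed first factor.  Finally
-- id● ∘ Π [] = id● ∘ η ∘ ε = 0, and for a singleton id● ∘ Π [v] = v is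
-- pointedness itself.

open import Defs
open import Data.List using (List; []; _∷_)
open import Data.List.Relation.Unary.All using (All; _∷_)
open import Data.Product using (_×_; _,_)
open import Relation.Binary.PropositionalEquality using (_≡_; _≢_; refl)
open import Relation.Binary using (IsEquivalence)
open import Relation.Binary.Bundles using (Setoid)
import Relation.Binary.Reasoning.Setoid as SetoidReasoning
open import Data.Empty using (⊥-elim)

module ResourceProperties {o ℓ e} (𝒞 : ResourceCategory o ℓ e) where
  open ResourceCategory 𝒞

  module _ {X Y : Obj} where
    open IsEquivalence (≈-equiv {X} {Y}) public
      renaming (refl to ≈-refl; sym to ≈-sym; trans to ≈-trans)

  hom-setoid : Obj → Obj → Setoid ℓ e
  hom-setoid X Y = record { Carrier = X ⇒ Y ; _≈_ = _≈_ ; isEquivalence = ≈-equiv }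

  ⊗-∘-fuse : ∀ {X Y₁ Y₂ Z₁ Z₂ W₁ W₂}
               {a : Z₁ ⇒ W₁} {b : Z₂ ⇒ W₂} {c : Y₁ ⇒ Z₁} {d : Y₂ ⇒ Z₂}
               {h : X ⇒ (Y₁ ⊗₀ Y₂)} →
             (a ⊗₁ b) ∘ ((c ⊗₁ d) ∘ h) ≈ ((a ∘ c) ⊗₁ (b ∘ d)) ∘ h
  ⊗-∘-fuse = ≈-trans (≈-sym assoc) (∘-resp-≈ (≈-sym ⊗-homomorphism) ≈-refl)

  0⊗-∘≈0 : ∀ {X Y₁ Y₂ Z₁ Z₂} {a : Y₂ ⇒ Z₂} {h : X ⇒ (Y₁ ⊗₀ Y₂)} →
           (0# {Y₁} {Z₁} ⊗₁ a) ∘ h ≈ 0#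
  0⊗-∘≈0 = ≈-trans (∘-resp-≈ ⊗-zeroˡ ≈-refl) ∘-zeroˡ

  ⊗0-∘≈0 : ∀ {X Y₁ Y₂ Z₁ Z₂} {a : Y₁ ⇒ Z₁} {h : X ⇒ (Y₁ ⊗₀ Y₂)} →
           (a ⊗₁ 0# {Y₂} {Z₂}) ∘ h ≈ 0#
  ⊗0-∘≈0 = ≈-trans (∘-resp-≈ ⊗-zeroʳ ≈-refl) ∘-zeroˡ

  ε∘pointed≈0 : ∀ {A B} {f : A ⇒ B} → Pointed f → ε B ∘ f ≈ 0#
  ε∘pointed≈0 {A} {B} {f} f-pointed = begin
    ε B ∘ f            ≈⟨ ∘-resp-≈ ≈-refl (≈-sym f-pointed) ⟩
    ε B ∘ (id● B ∘ f)  ≈⟨ ≈-sym assoc ⟩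
    (ε B ∘ id● B) ∘ f  ≈⟨ ∘-resp-≈ ε-id● ≈-refl ⟩
    0# ∘ f             ≈⟨ ∘-zeroˡ ⟩
    0#                 ∎
    where open SetoidReasoning (hom-setoid A I)

  ε∘*≈0 : ∀ {A B} {g h : A ⇒ B} → ε B ∘ g ≈ 0# → ε B ∘ (g * h) ≈ 0#
  ε∘*≈0 {A} {B} {g} {h} εg≈0 = begin
    ε B ∘ (μ B ∘ (g ⊗₁ h) ∘ δ A)                ≈⟨ ≈-sym assoc ⟩
    (ε B ∘ μ B) ∘ ((g ⊗₁ h) ∘ δ A)              ≈⟨ ∘-resp-≈ ε-μ ≈-refl ⟩
    (λ⇒ ∘ (ε B ⊗₁ ε B)) ∘ ((g ⊗₁ h) ∘ δ A)      ≈⟨ assoc ⟩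
    λ⇒ ∘ ((ε B ⊗₁ ε B) ∘ ((g ⊗₁ h) ∘ δ A))      ≈⟨ ∘-resp-≈ ≈-refl ⊗-∘-fuse ⟩
    λ⇒ ∘ (((ε B ∘ g) ⊗₁ (ε B ∘ h)) ∘ δ A)       ≈⟨ ∘-resp-≈ ≈-refl
                                                     (∘-resp-≈ (⊗-resp-≈ εg≈0 ≈-refl) ≈-refl) ⟩
    λ⇒ ∘ ((0# ⊗₁ (ε B ∘ h)) ∘ δ A)              ≈⟨ ∘-resp-≈ ≈-refl 0⊗-∘≈0 ⟩
    λ⇒ ∘ 0#                                     ≈⟨ ∘-zeroʳ ⟩
    0#                                          ∎
    where open SetoidReasoning (hom-setoid A I)

  ε∘Π≈0 : ∀ {A B} {g : A ⇒ B} (fs : List (A ⇒ B)) →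
          ε B ∘ g ≈ 0# → ε B ∘ Π (g ∷ fs) ≈ 0#
  ε∘Π≈0 []      εg≈0 = εg≈0
  ε∘Π≈0 (_ ∷ _) εg≈0 = ε∘*≈0 εg≈0

  id●∘*≈0 : ∀ {A B} {g h : A ⇒ B} →
            ε B ∘ g ≈ 0# → ε B ∘ h ≈ 0# → id● B ∘ (g * h) ≈ 0#
  id●∘*≈0 {A} {B} {g} {h} εg≈0 εh≈0 = begin
    id● B ∘ (μ B ∘ (g ⊗₁ h) ∘ δ A)              ≈⟨ ≈-sym assoc ⟩
    (id● B ∘ μ B) ∘ ((g ⊗₁ h) ∘ δ A)            ≈⟨ ∘-resp-≈ id●-μ ≈-refl ⟩
    ((ρ⇒ ∘ (id● B ⊗₁ ε B)) + (λ⇒ ∘ (ε B ⊗₁ id● B))) ∘ ((g ⊗₁ h) ∘ δ A)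
                                                ≈⟨ ∘-distribʳ-+ ⟩
    ((ρ⇒ ∘ (id● B ⊗₁ ε B)) ∘ ((g ⊗₁ h) ∘ δ A))
      + ((λ⇒ ∘ (ε B ⊗₁ id● B)) ∘ ((g ⊗₁ h) ∘ δ A))
                                                ≈⟨ +-resp-≈ (≈-trans assoc (∘-resp-≈ ≈-refl ⊗-∘-fuse))
                                                            (≈-trans assoc (∘-resp-≈ ≈-refl ⊗-∘-fuse)) ⟩
    (ρ⇒ ∘ (((id● B ∘ g) ⊗₁ (ε B ∘ h)) ∘ δ A))
      + (λ⇒ ∘ (((ε B ∘ g) ⊗₁ (id● B ∘ h)) ∘ δ A))
                                                ≈⟨ +-resp-≈ (∘-resp-≈ ≈-refl (∘-resp-≈ (⊗-resp-≈ ≈-refl εh≈0) ≈-refl))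
                                                            (∘-resp-≈ ≈-refl (∘-resp-≈ (⊗-resp-≈ εg≈0 ≈-refl) ≈-refl)) ⟩
    (ρ⇒ ∘ (((id● B ∘ g) ⊗₁ 0#) ∘ δ A))
      + (λ⇒ ∘ ((0# ⊗₁ (id● B ∘ h)) ∘ δ A))
                                                ≈⟨ +-resp-≈ (≈-trans (∘-resp-≈ ≈-refl ⊗0-∘≈0) ∘-zeroʳ)
                                                            (≈-trans (∘-resp-≈ ≈-refl 0⊗-∘≈0) ∘-zeroʳ) ⟩
    0# + 0#                                     ≈⟨ +-identityˡ ⟩
    0#                                          ∎
    where open SetoidReasoning (hom-setoid A B)

  id●∘one≈0 : ∀ {A B} → id● B ∘ one {A} {B} ≈ 0#
  id●∘one≈0 = ≈-trans (≈-sym assoc) (≈-trans (∘-resp-≈ id●-η ≈-refl) ∘-zeroˡ)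

lemma6p6 : ∀ {o ℓ e} (𝒞 : ResourceCategory o ℓ e) →
           let open ResourceCategory 𝒞 in
           ∀ {A B} (fs : List (A ⇒ B)) → All Pointed fs →
           (∀ (v : A ⇒ B) → fs ≡ v ∷ [] → id● B ∘ Π fs ≈ v)
           × ((∀ (v : A ⇒ B) → fs ≢ v ∷ []) → id● B ∘ Π fs ≈ 0#)
lemma6p6 𝒞 [] _ = (λ _ ()) , λ _ → id●∘one≈0
  where open ResourceProperties 𝒞
lemma6p6 𝒞 (f ∷ []) (f-pointed ∷ _) =
  (λ { _ refl → f-pointed }) , λ not-singleton → ⊥-elim (not-singleton f refl)
lemma6p6 𝒞 (f ∷ g ∷ fs) (f-pointed ∷ g-pointed ∷ _) =
  (λ _ ()) , λ _ → id●∘*≈0 (ε∘pointed≈0 f-pointed) (ε∘Π≈0 fs (ε∘pointed≈0 g-pointed))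
  where open ResourceProperties 𝒞
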